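{- If $G$ is a well-covered bipartite graph, then $\operatorname{indmatch} G=\operatorname{cochord} G$.
   Context: All graphs are finite and simple. A graph is well-covered if every maximal independent set has the same cardinality. An induced matching is a set of pairwise disjoint edges forming an induced subgraph; $\operatorname{indmatch} G$ is the maximum number of edges in an induced matching. A graph is co-chordal if its complement is chordal (every induced cycle has length 3); $\operatorname{cochord} G$ is the minimum number of co-chordal subgraphs of $G$ whose edge sets together cover $E(G)$. -}

module Defs where

open import Data.Nat using (ℕ; zero; suc; _≤_)
open import Data.Fin using (Fin; toℕ)
open import Data.Fin.Subset using (Subset; _∈_; _∉_; _⊆_; ∣_∣)
open import Data.Bool using (Bool; true; false; not)
open import Data.Product using (Σ; _×_; _,_; proj₁; proj₂; ∃)
open import Data.Sum using (_⊎_)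
open import Data.List using (List; length)
open import Data.List.Relation.Unary.Any using (Any)
open import Data.List.Relation.Unary.All using (All)
open import Relation.Binary.PropositionalEquality using (_≡_; _≢_)

record Graph (n : ℕ) : Set where
  field
    adj     : Fin n → Fin n → Bool
    adj-sym : ∀ i j → adj i j ≡ adj j i
    irrefl  : ∀ i → adj i i ≡ false
open Graph public

Edge : ∀ {n} → Graph n → Fin n → Fin n → Set
Edge G i j = adj G i j ≡ true

Independent : ∀ {n} → Graph n → Subset n → Set
Independent G S = ∀ i j → i ∈ S → j ∈ S → adj G i j ≡ false

MaximalIndependent : ∀ {n} → Graph n → Subset n → Set
MaximalIndependent G S =
  Independent G S × (∀ T → Independent G T → S ⊆ T → T ⊆ S)

WellCovered : ∀ {n} → Graph n → Set
WellCovered G = ∀ S T → MaximalIndependent G S → MaximalIndependent G T → ∣ S ∣ ≡ ∣ T ∣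

Bipartite : ∀ {n} → Graph n → Set
Bipartite {n} G = Σ (Fin n → Bool) λ c → ∀ i j → Edge G i j → c i ≢ c j

record InducedMatching {n} (G : Graph n) (k : ℕ) : Set where
  field
    u v      : Fin k → Fin n
    isEdge   : ∀ a → Edge G (u a) (v a)
    disjoint : ∀ a b → a ≢ b →
                 (u a ≢ u b) × (u a ≢ v b) × (v a ≢ u b) × (v a ≢ v b)
    induced  : ∀ a b → a ≢ b →
                 (adj G (u a) (u b) ≡ false) × (adj G (u a) (v b) ≡ false)
                 × (adj G (v a) (u b) ≡ false) × (adj G (v a) (v b) ≡ false)

IsIndmatch : ∀ {n} → Graph n → ℕ → Set
IsIndmatch G k = InducedMatching G k × (∀ m → InducedMatching G m → m ≤ k)

CycAdj : ∀ {k} → Fin k → Fin k → Set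
CycAdj {k} i j =
  suc (toℕ i) ≡ toℕ j ⊎ suc (toℕ j) ≡ toℕ i
  ⊎ (toℕ i ≡ 0 × suc (toℕ j) ≡ k) ⊎ (toℕ j ≡ 0 × suc (toℕ i) ≡ k)

record InducedCycle {n} (G : Graph n) (k : ℕ) : Set where
  field
    f        : Fin k → Fin n
    injective : ∀ i j → f i ≡ f j → i ≡ j
    edges    : ∀ i j → CycAdj i j → Edge G (f i) (f j)
    nonedges : ∀ i j → Edge G (f i) (f j) → CycAdj i j

Chordal : ∀ {n} → Graph n → Set
Chordal G = ∀ k → 3 ≤ k → InducedCycle G k → k ≡ 3

complement : ∀ {n} → Graph n → Graph n
complement {n} G = record
  { adj     = λ i j → not (adj G i j) ∧' neq i j
  ; adj-sym = λ i j → symc i j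
  ; irrefl  = λ i → irc i
  }
  where
  open import Data.Bool using (_∧_)
  open import Data.Fin using (_≟_)
  open import Relation.Nullary using (does; yes; no)
  open import Data.Bool.Properties using (∧-comm)
  open import Relation.Binary.PropositionalEquality using (refl; sym; cong; cong₂)
  _∧'_ = _∧_
  neq : Fin n → Fin n → Bool
  neq i j = not (does (i Data.Fin.≟ j))
  neq-sym : ∀ i j → neq i j ≡ neq j i
  neq-sym i j with i ≟ j | j ≟ i
  ... | yes _ | yes _ = refl
  ... | no _  | no _  = refl
  ... | yes p | no q  with q (sym p)
  ... | ()
  neq-sym i j | no q | yes p with q (sym p)
  ... | ()
  symc : ∀ i j → (not (adj G i j) ∧ neq i j) ≡ (not (adj G j i) ∧ neq j i)
  symc i j = cong₂ _∧_ (cong not (adj-sym G i j)) (neq-sym i j)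
  irc : ∀ i → (not (adj G i i) ∧ neq i i) ≡ false
  irc i with i ≟ i
  ... | yes _ = ∧-comm (not (adj G i i)) false
  ... | no ¬p with ¬p refl
  ... | ()

CoChordal : ∀ {n} → Graph n → Set
CoChordal G = Chordal (complement G)

Subgraph : ∀ {n} → Graph n → Graph n → Set
Subgraph H G = ∀ i j → Edge H i j → Edge G i j

record CoChordalCover {n} (G : Graph n) : Set where
  field
    parts     : List (Graph n)
    subgraphs : All (λ H → Subgraph H G) parts
    cochordal : All CoChordal parts
    covers    : ∀ i j → Edge G i j → Any (λ H → Edge H i j) parts

IsCochord : ∀ {n} → Graph n → ℕ → Set
IsCochord G k =
  (Σ (CoChordalCover G) λ C → length (CoChordalCover.parts C) ≡ k)
  × (∀ (C : CoChordalCover G) → k ≤ length (CoChordalCover.parts C))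

-- Two edges of an induced matching span an induced 2K2, whose complement is a 4-cycle, so
-- they lie in different parts of any co-chordal cover: indmatch ≤ cochord for every graph.
--
-- Conversely, let A and B be the non-isolated vertices of the two colour classes. As G is
-- well-covered, every maximal independent set contains exactly |B| non-isolated vertices.
-- In the order where each x ∈ A lies below its neighbours, antichains are independent, so
-- by Dilworth's theorem the non-isolated vertices split into at most |B| chains; each chain
-- is then an edge x (mate x), and a maximal independent set through a non-edge x′z with
-- mate x ∼ x′ and x ∼ z would miss a whole chain. Hence N(x) ⊆ N(x′) whenever mate x ∼ x′.
-- Dilworth's theorem for neighbourhood inclusion on A now gives an antichain u₁, …, u_s
-- and w ≤ s chains. The edges u_a (mate u_a) form an induced matching, and the edges at
-- the vertices of one chain form a bipartite graph without induced 2K2 (the neighbourhoods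
-- are nested); it is co-chordal because the colour classes are cliques of its complement.

module Submission where

open import Defs
open import Data.Bool using (Bool; true; false; not; _∧_; _∨_)
open import Data.Bool.Properties
  using (∧-conicalˡ; ∧-conicalʳ; ∨-zeroʳ; ∧-identityʳ; ∨-comm; ¬-not)
import Data.Bool.Properties as Bool
open import Data.Empty using (⊥; ⊥-elim)
open import Data.Fin using (Fin; zero; suc; toℕ; _≟_; inject₁; fromℕ)
open import Data.Fin.Patterns using (0F; 1F; 2F; 3F; 4F)
open import Data.Fin.Properties
  using (any?; all?; 0≢1+n; suc-injective; inject₁-injective; fromℕ≢inject₁; injective⇒≤)
open import Data.Fin.Subset using (Subset; ∣_∣) renaming (_∈_ to _∈ₛ_; _⊆_ to _⊆ₛ_)
open import Data.Fin.Subset.Properties using (anySubset?)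
open import Data.List using (List; []; _∷_; length; allFin)
import Data.List as List
open import Data.List.Properties using (length-tabulate)
open import Data.List.Membership.Propositional using (_∈_)
open import Data.List.Membership.Propositional.Properties using (∈-allFin)
open import Data.List.Relation.Unary.Any using (Any; here; there; index)
open import Data.List.Relation.Unary.All using (lookupAny)
import Data.List.Relation.Unary.All.Properties as All
import Data.List.Relation.Unary.Any.Properties as Any
import Data.Nat as ℕ
open import Data.Nat using (ℕ; zero; suc; _+_; _≤_; _<_; z≤n; s≤s; _≤?_)
open import Data.Nat.Properties
  using ( ≤-refl; ≤-trans; ≤-reflexive; ≤-antisym; ≤-pred; ≰⇒>; <-irrefl
        ; +-mono-≤; +-suc; +-cancelʳ-≡; +-commutativeSemigroup; module ≤-Reasoning)
open import Algebra.Properties.CommutativeSemigroup +-commutativeSemigroup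
  using () renaming (interchange to +-interchange)
open import Data.Product using (Σ; ∃; _×_; _,_; proj₁; proj₂)
open import Data.Sum using (_⊎_; inj₁; inj₂; map; map₂; [_,_]′)
open import Data.Vec using (lookup; tabulate)
open import Data.Vec.Properties using (lookup∘tabulate; []=⇒lookup; lookup⇒[]=)
open import Function using (id)
open import Relation.Nullary using (Dec; yes; no; does; ¬_; _×-dec_; _⊎-dec_; _→-dec_; ¬?)
open import Relation.Nullary.Decidable using (dec-true; dec-false; from-yes; from-no)
open import Relation.Binary.PropositionalEquality

≡true⇒≢false : ∀ {a} → a ≡ true → ¬ a ≡ false
≡true⇒≢false refl ()

∧-intro : ∀ {a b} → a ≡ true → b ≡ true → a ∧ b ≡ true
∧-intro refl refl = refl

∨-introˡ : ∀ {a} b → a ≡ true → a ∨ b ≡ true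
∨-introˡ b refl = refl

∨-introʳ : ∀ a {b} → b ≡ true → a ∨ b ≡ true
∨-introʳ a refl = ∨-zeroʳ a

∨-elim : ∀ a {b} → a ∨ b ≡ true → a ≡ true ⊎ b ≡ true
∨-elim true  _ = inj₁ refl
∨-elim false e = inj₂ e

not-true : ∀ {a} → not a ≡ true → a ≡ false
not-true {false} _ = refl

≢true : ∀ {a} → ¬ a ≡ true → a ≡ false
≢true = ¬-not

does-true : ∀ {A : Set} (d : Dec A) → does d ≡ true → A
does-true (yes a) _ = a

does-false : ∀ {A : Set} (d : Dec A) → does d ≡ false → ¬ A
does-false (no ¬a) _ = ¬a

_==_ : ∀ {n} → Fin n → Fin n → Bool
i == j = does (i ≟ j)

==-refl : ∀ {n} (i : Fin n) → i == i ≡ true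
==-refl i = dec-true (i ≟ i) refl

==-true : ∀ {n} {i j : Fin n} → i == j ≡ true → i ≡ j
==-true {i = i} {j} = does-true (i ≟ j)

==-false : ∀ {n} {i j : Fin n} → i ≢ j → i == j ≡ false
==-false {i = i} {j} = dec-false (i ≟ j)

_∖_ : ∀ {n} → (Fin n → Bool) → (Fin n → Bool) → (Fin n → Bool)
(p ∖ q) i = p i ∧ not (q i)

∖-intro : ∀ {n} (p q : Fin n → Bool) {i} → p i ≡ true → q i ≡ false → (p ∖ q) i ≡ true
∖-intro p q pi qi = ∧-intro pi (cong not qi)

_─_ : ∀ {n} → (Fin n → Bool) → Fin n → (Fin n → Bool)
p ─ j = p ∖ (_== j)

─-intro : ∀ {n} (p : Fin n → Bool) {i j} → p i ≡ true → i ≢ j → (p ─ j) i ≡ true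
─-intro p {j = j} pi i≢j = ∖-intro p (_== j) pi (==-false i≢j)

_⊆_ : ∀ {n} → (Fin n → Bool) → (Fin n → Bool) → Set
p ⊆ q = ∀ x → p x ≡ true → q x ≡ true

indicator : Bool → ℕ
indicator true  = 1
indicator false = 0

count : ∀ {n} → (Fin n → Bool) → ℕ
count {zero}  p = 0
count {suc n} p = indicator (p zero) + count (λ i → p (suc i))

MapsTo : ∀ {n m} → (Fin n → Bool) → (Fin m → Bool) → (Fin n → Fin m) → Set
MapsTo p q f = ∀ i → p i ≡ true → q (f i) ≡ true

InjectiveOn : ∀ {n m} → (Fin n → Bool) → (Fin n → Fin m) → Set
InjectiveOn p f = ∀ i i′ → p i ≡ true → p i′ ≡ true → f i ≡ f i′ → i ≡ i′

count-cong : ∀ {n} {p q : Fin n → Bool} → (∀ i → p i ≡ q i) → count p ≡ count q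
count-cong {zero}  _   = refl
count-cong {suc n} p≗q =
  cong₂ _+_ (cong indicator (p≗q zero)) (count-cong (λ i → p≗q (suc i)))

indicator-mono : ∀ {a b} → (a ≡ true → b ≡ true) → indicator a ≤ indicator b
indicator-mono {false} _ = z≤n
indicator-mono {true}  h rewrite h refl = ≤-refl

count-mono : ∀ {n} {p q : Fin n → Bool} → p ⊆ q → count p ≤ count q
count-mono {zero}  _   = z≤n
count-mono {suc n} p⊆q = +-mono-≤ (indicator-mono (p⊆q zero)) (count-mono (λ i → p⊆q (suc i)))

count-full : ∀ m → count {m} (λ _ → true) ≡ m
count-full zero    = refl
count-full (suc m) = cong suc (count-full m)

indicator-split : ∀ a b → indicator a ≡ indicator (a ∧ b) + indicator (a ∧ not b)
indicator-split false _     = refl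
indicator-split true  false = refl
indicator-split true  true  = refl

count-split : ∀ {n} (p r : Fin n → Bool) →
  count p ≡ count (λ i → p i ∧ r i) + count (λ i → p i ∧ not (r i))
count-split {zero}  _ _ = refl
count-split {suc n} p r = trans
  (cong₂ _+_ (indicator-split (p zero) (r zero)) (count-split (λ i → p (suc i)) (λ i → r (suc i))))
  (+-interchange (indicator (p zero ∧ r zero)) (indicator (p zero ∧ not (r zero))) _ _)

count-─ : ∀ {n} (p : Fin n → Bool) j → p j ≡ true → count p ≡ suc (count (p ─ j))
count-─ {suc n} p zero pj rewrite pj =
  cong suc (count-cong (λ i → sym (∧-identityʳ (p (suc i)))))
count-─ {suc n} p (suc j) pj = begin
  indicator (p zero) + count (λ i → p (suc i))
    ≡⟨ cong (indicator (p zero) +_) (count-─ (λ i → p (suc i)) j pj) ⟩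
  indicator (p zero) + suc (count rest)
    ≡⟨ +-suc (indicator (p zero)) (count rest) ⟩
  suc (indicator (p zero) + count rest)
    ≡⟨ cong (λ b → suc (indicator b + count rest)) (sym (∧-identityʳ (p zero))) ⟩
  suc (count (p ─ suc j)) ∎
  where
  open ≡-Reasoning
  rest = (λ i → p (suc i)) ─ j

injective-suc : ∀ {n m} {p : Fin (suc n) → Bool} {f : Fin (suc n) → Fin m} →
  InjectiveOn p f → InjectiveOn (λ i → p (suc i)) (λ i → f (suc i))
injective-suc inj i i′ pi pi′ e = suc-injective (inj (suc i) (suc i′) pi pi′ e)

injective⇒count≤ : ∀ {n m} {p : Fin n → Bool} {q : Fin m → Bool} (f : Fin n → Fin m) →
  MapsTo p q f → InjectiveOn p f → count p ≤ count q
injective⇒count≤ {zero} f _ _ = z≤n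
injective⇒count≤ {suc n} {p = p} {q} f maps inj with p zero in p0
... | false = injective⇒count≤ (λ i → f (suc i)) (λ i → maps (suc i)) (injective-suc inj)
... | true = begin
  suc (count (λ i → p (suc i)))
    ≤⟨ s≤s (injective⇒count≤ (λ i → f (suc i)) maps′ (injective-suc inj)) ⟩
  suc (count (q ─ f zero))
    ≡⟨ sym (count-─ q (f zero) (maps zero p0)) ⟩
  count q ∎
  where
  open ≤-Reasoning
  maps′ : MapsTo (λ i → p (suc i)) (q ─ f zero) (λ i → f (suc i))
  maps′ i pi = ─-intro q (maps (suc i) pi) (λ e → 0≢1+n (sym (inj (suc i) zero pi p0 e)))

count≤⇒surjective : ∀ {n m} {p : Fin n → Bool} {q : Fin m → Bool} (f : Fin n → Fin m) →
  MapsTo p q f → InjectiveOn p f → count q ≤ count p →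
  ∀ j → q j ≡ true → ∃ λ i → p i ≡ true × f i ≡ j
count≤⇒surjective {p = p} {q} f maps inj q≤p j qj
  with any? (λ i → (p i Bool.≟ true) ×-dec (f i ≟ j))
... | yes hit = hit
... | no miss = ⊥-elim (<-irrefl refl (begin-strict
  count p        ≤⟨ injective⇒count≤ f maps′ inj ⟩
  count (q ─ j)  <⟨ ≤-reflexive (sym (count-─ q j qj)) ⟩
  count q        ≤⟨ q≤p ⟩
  count p        ∎))
  where
  open ≤-Reasoning
  maps′ : MapsTo p (q ─ j) f
  maps′ i pi = ─-intro q (maps i pi) (λ fi≡j → miss (i , pi , fi≡j))

∣tabulate∣≡count : ∀ {n} (p : Fin n → Bool) → ∣ tabulate p ∣ ≡ count p
∣tabulate∣≡count {zero}  p = refl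
∣tabulate∣≡count {suc n} p with p zero
... | true  = cong suc (∣tabulate∣≡count (λ i → p (suc i)))
... | false = ∣tabulate∣≡count (λ i → p (suc i))

-- Dilworth's theorem for decidable preorders

positive : ∀ {w} → Fin (suc w) → Bool
positive zero    = false
positive (suc _) = true

count-positive : ∀ w → count (positive {w}) ≡ w
count-positive = count-full

module Dilworth {n : ℕ} (_≼_ : Fin n → Fin n → Bool)
  (≼-refl : ∀ x → x ≼ x ≡ true)
  (≼-trans : ∀ {x y z} → x ≼ y ≡ true → y ≼ z ≡ true → x ≼ z ≡ true) where

  Comparable : Fin n → Fin n → Set
  Comparable x y = x ≼ y ≡ true ⊎ y ≼ x ≡ true

  IsChain : (Fin n → Bool) → Set
  IsChain K = ∀ x y → K x ≡ true → K y ≡ true → Comparable x y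

  IsAntichain : (P S : Fin n → Bool) → Set
  IsAntichain P S = S ⊆ P × (∀ x y → S x ≡ true → S y ≡ true → x ≢ y → x ≼ y ≡ false)

  record Antichain (P : Fin n → Bool) (s : ℕ) : Set where
    field
      element      : Fin s → Fin n
      element∈P    : ∀ i → P (element i) ≡ true
      incomparable : ∀ i j → i ≢ j → element i ≼ element j ≡ false

  -- Chains are numbered 1, …, w; the index 0 collects the points outside P.
  record ChainPartition (P : Fin n → Bool) (w : ℕ) : Set where
    field
      chain            : Fin n → Fin (suc w)
      chain≢0          : ∀ x → P x ≡ true → chain x ≢ zero
      chain-comparable : ∀ x y → P x ≡ true → P y ≡ true → chain x ≡ chain y → Comparable x y

  record Decomposition (P : Fin n → Bool) : Set where
    field
      width chains : ℕ
      antichain    : Antichain P width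
      partition    : ChainPartition P chains
      chains≤width : chains ≤ width

  IsAntichain-cong : ∀ {P S S′} → (∀ x → S x ≡ S′ x) → IsAntichain P S → IsAntichain P S′
  IsAntichain-cong S≗S′ (S⊆P , anti) =
    (λ x e → S⊆P x (trans (S≗S′ x) e)) ,
    (λ x y ex ey → anti x y (trans (S≗S′ x) ex) (trans (S≗S′ y) ey))

  IsAntichain-mono : ∀ {P Q S} → P ⊆ Q → IsAntichain P S → IsAntichain Q S
  IsAntichain-mono P⊆Q (S⊆P , anti) = (λ x e → P⊆Q x (S⊆P x e)) , anti

  isAntichain? : ∀ P S → Dec (IsAntichain P S)
  isAntichain? P S =
    all? (λ x → (S x Bool.≟ true) →-dec (P x Bool.≟ true)) ×-dec
    all? (λ x → all? λ y → (S x Bool.≟ true) →-dec (S y Bool.≟ true) →-dec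
                             ¬? (x ≟ y) →-dec (x ≼ y Bool.≟ false))

  module _ {P : Fin n → Bool} {w : ℕ} (C : ChainPartition P w) where
    open ChainPartition C

    chain-injective : ∀ {S} → IsAntichain P S → InjectiveOn S chain
    chain-injective (S⊆P , anti) x y Sx Sy same with x ≟ y
    ... | yes x≡y = x≡y
    ... | no x≢y with chain-comparable x y (S⊆P x Sx) (S⊆P y Sy) same
    ...   | inj₁ x≼y = ⊥-elim (≡true⇒≢false x≼y (anti x y Sx Sy x≢y))
    ...   | inj₂ y≼x = ⊥-elim (≡true⇒≢false y≼x (anti y x Sy Sx (λ e → x≢y (sym e))))

    chain-positive : ∀ {S} → IsAntichain P S → MapsTo S positive chain
    chain-positive (S⊆P , _) x Sx with chain x | chain≢0 x (S⊆P x Sx)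
    ... | zero  | ≢0 = ⊥-elim (≢0 refl)
    ... | suc _ | _  = refl

    antichain-meets-chains : ∀ {S} → IsAntichain P S → w ≤ count S →
      ∀ t → ∃ λ y → S y ≡ true × chain y ≡ suc t
    antichain-meets-chains {S} S-anti w≤S t =
      count≤⇒surjective {q = positive} chain (chain-positive {S} S-anti) (chain-injective {S} S-anti)
        (subst (_≤ count S) (sym (count-positive w)) w≤S) (suc t) refl

  module _ {P : Fin n → Bool} {s : ℕ} (A : Antichain P s) where
    open Antichain A

    element-injective : ∀ {i j} → element i ≡ element j → i ≡ j
    element-injective {i} {j} e with i ≟ j
    ... | yes i≡j = i≡j
    ... | no i≢j  = ⊥-elim (≡true⇒≢false (subst (λ y → element i ≼ y ≡ true) e (≼-refl (element i)))
                                         (incomparable i j i≢j))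

    image : Fin n → Bool
    image y = does (any? λ i → element i ≟ y)

    image-antichain : IsAntichain P image
    image-antichain = image⊆P , anti
      where
      image⊆P : image ⊆ P
      image⊆P y e with does-true (any? λ i → element i ≟ y) e
      ... | i , refl = element∈P i
      anti : ∀ x y → image x ≡ true → image y ≡ true → x ≢ y → x ≼ y ≡ false
      anti x y ex ey x≢y
        with does-true (any? λ i → element i ≟ x) ex | does-true (any? λ i → element i ≟ y) ey
      ... | i , refl | j , refl = incomparable i j (λ i≡j → x≢y (cong element i≡j))

    width≤image : s ≤ count image
    width≤image = subst (_≤ count image) (count-full s)
      (injective⇒count≤ {q = image} element (λ i _ → dec-true (any? λ j → element j ≟ element i) (i , refl))
                       (λ i j _ _ → element-injective))

  Maximal : (Fin n → Bool) → Fin n → Set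
  Maximal D m = D m ≡ true × (∀ z → D z ≡ true → m ≼ z ≡ true → z ≼ m ≡ true)

  MaximalIn : (Fin n → Bool) → List (Fin n) → Fin n → Set
  MaximalIn D xs m = D m ≡ true × (∀ z → z ∈ xs → D z ≡ true → m ≼ z ≡ true → z ≼ m ≡ true)

  maximal-in : (D : Fin n → Bool) (xs : List (Fin n)) →
    ∃ (MaximalIn D xs) ⊎ (∀ z → z ∈ xs → D z ≡ false)
  maximal-in D [] = inj₂ (λ _ ())
  maximal-in D (x ∷ xs) with maximal-in D xs | D x in Dx
  ... | inj₂ none | false = inj₂ λ
    { z (here refl)   → Dx
    ; z (there z∈xs) → none z z∈xs }
  ... | inj₂ none | true = inj₁ (x , Dx , λ
    { z (here refl)   _  x≼z → x≼z
    ; z (there z∈xs) Dz _   → ⊥-elim (≡true⇒≢false Dz (none z z∈xs)) })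
  ... | inj₁ (m , Dm , max) | false = inj₁ (m , Dm , λ
    { z (here refl)   Dz _ → ⊥-elim (≡true⇒≢false Dz Dx)
    ; z (there z∈xs) → max z z∈xs })
  ... | inj₁ (m , Dm , max) | true with m ≼ x in m≼x
  ...   | true = inj₁ (x , Dx , λ
    { z (here refl)   _  x≼z → x≼z
    ; z (there z∈xs) Dz x≼z → ≼-trans (max z z∈xs Dz (≼-trans m≼x x≼z)) m≼x })
  ...   | false = inj₁ (m , Dm , λ
    { z (here refl)   _ m≼z → ⊥-elim (≡true⇒≢false m≼z m≼x)
    ; z (there z∈xs) → max z z∈xs })

  maximal : (D : Fin n → Bool) → ∀ z → D z ≡ true → ∃ (Maximal D)
  maximal D z Dz with maximal-in D (allFin n)
  ... | inj₁ (m , Dm , max) = m , Dm , λ y → max y (∈-allFin y)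
  ... | inj₂ none = ⊥-elim (≡true⇒≢false Dz (none z (∈-allFin z)))

  greatest : (D : Fin n → Bool) → IsChain D → ∀ z → D z ≡ true →
    ∃ λ m → D m ≡ true × (∀ y → D y ≡ true → y ≼ m ≡ true)
  greatest D D-chain z Dz with maximal D z Dz
  ... | m , Dm , max = m , Dm , λ y Dy → [ id , max y Dy ]′ (D-chain y m Dy Dm)

  extend : ∀ {P K : Fin n → Bool} {w} →
    ChainPartition (P ∖ K) w → IsChain K → ChainPartition P (suc w)
  extend {P} {K} {w} C K-chain = record
    { chain = λ x → place (K x) (chain x) ; chain≢0 = chain≢0′ ; chain-comparable = comparable }
    where
    open ChainPartition C
    place : Bool → Fin (suc w) → Fin (suc (suc w))
    place true  _ = fromℕ (suc w)
    place false t = inject₁ t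
    chain≢0′ : ∀ x → P x ≡ true → place (K x) (chain x) ≢ zero
    chain≢0′ x Px with K x in Kx
    ... | true  = λ ()
    ... | false = λ e → chain≢0 x (∖-intro P K Px Kx) (inject₁-injective e)
    comparable : ∀ x y → P x ≡ true → P y ≡ true →
      place (K x) (chain x) ≡ place (K y) (chain y) → Comparable x y
    comparable x y Px Py e with K x in Kx | K y in Ky
    ... | true  | true  = K-chain x y Kx Ky
    ... | true  | false = ⊥-elim (fromℕ≢inject₁ e)
    ... | false | true  = ⊥-elim (fromℕ≢inject₁ (sym e))
    ... | false | false = chain-comparable x y (∖-intro P K Px Kx) (∖-intro P K Py Ky) (inject₁-injective e)

  -- Galvin's induction step. With k chains for P ─ a, call an antichain of P ─ a of size
  -- at least k wide, and let x t be the greatest point of chain t lying in a wide antichain.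
  -- The x t form an antichain. If none lies below a, add a to it and {a} as a new chain;
  -- otherwise x t₀ ≼ a, and splitting off the chain K = {a} ∪ {z on chain t₀ | z ≼ x t₀}
  -- leaves P ∖ K without wide antichains.
  module GalvinStep {P : Fin n → Bool} {a : Fin n} (a-max : Maximal P a)
    (recurse : ∀ Q → Q ⊆ (P ─ a) → Decomposition Q) where

    P′ : Fin n → Bool
    P′ = P ─ a

    P′⊆P : P′ ⊆ P
    P′⊆P x = ∧-conicalˡ (P x) _

    open Decomposition (recurse P′ (λ _ → id))
      using (partition; chains≤width) renaming (antichain to A′; chains to k)
    open ChainPartition partition

    Wide : (Fin n → Bool) → Set
    Wide S = IsAntichain P′ S × k ≤ count S

    InWide : Fin n → Set
    InWide z = ∃ λ (S : Subset n) → Wide (lookup S) × lookup S z ≡ true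

    inWide : ∀ {S} z → Wide S → S z ≡ true → InWide z
    inWide {S} z (anti , k≤S) Sz =
      tabulate S ,
      (IsAntichain-cong S≗ anti , subst (k ≤_) (count-cong S≗) k≤S) ,
      trans (lookup∘tabulate S z) Sz
      where
      S≗ : ∀ x → S x ≡ lookup (tabulate S) x
      S≗ x = sym (lookup∘tabulate S x)

    inWide? : ∀ z → Dec (InWide z)
    inWide? z = anySubset? λ S →
      (isAntichain? P′ (lookup S) ×-dec k ≤? count (lookup S)) ×-dec (lookup S z Bool.≟ true)

    inWide⇒P′ : ∀ {z} → InWide z → P′ z ≡ true
    inWide⇒P′ (S , ((S⊆P′ , _) , _) , Sz) = S⊆P′ _ Sz

    Candidate : Fin k → Fin n → Bool
    Candidate t z = does (inWide? z) ∧ (chain z == suc t)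

    candidate-intro : ∀ {t z} → InWide z → chain z ≡ suc t → Candidate t z ≡ true
    candidate-intro {t} {z} w e =
      ∧-intro (dec-true (inWide? z) w) (trans (cong (_== suc t) e) (==-refl (suc t)))

    candidate-inWide : ∀ {t z} → Candidate t z ≡ true → InWide z
    candidate-inWide {t} {z} e = does-true (inWide? z) (∧-conicalˡ _ _ e)

    candidate-chain : ∀ {t z} → Candidate t z ≡ true → chain z ≡ suc t
    candidate-chain {t} {z} e = ==-true (∧-conicalʳ (does (inWide? z)) _ e)

    candidates-chain : ∀ t → IsChain (Candidate t)
    candidates-chain t y z ty tz =
      chain-comparable y z (inWide⇒P′ (candidate-inWide ty)) (inWide⇒P′ (candidate-inWide tz))
        (trans (candidate-chain ty) (sym (candidate-chain tz)))

    image-wide : Wide (image A′)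
    image-wide = image-antichain A′ , ≤-trans chains≤width (width≤image A′)

    candidate-exists : ∀ t → ∃ λ z → Candidate t z ≡ true
    candidate-exists t with antichain-meets-chains partition (proj₁ image-wide) (proj₂ image-wide) t
    ... | z , z∈image , chain-z = z , candidate-intro (inWide z image-wide z∈image) chain-z

    greatest-candidate : ∀ t → ∃ λ m → Candidate t m ≡ true × (∀ y → Candidate t y ≡ true → y ≼ m ≡ true)
    greatest-candidate t =
      greatest (Candidate t) (candidates-chain t) (proj₁ (candidate-exists t)) (proj₂ (candidate-exists t))

    x : Fin k → Fin n
    x t = proj₁ (greatest-candidate t)

    x-inWide : ∀ t → InWide (x t)
    x-inWide t = candidate-inWide (proj₁ (proj₂ (greatest-candidate t)))

    x-chain : ∀ t → chain (x t) ≡ suc t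
    x-chain t = candidate-chain (proj₁ (proj₂ (greatest-candidate t)))

    x∈P : ∀ t → P (x t) ≡ true
    x∈P t = P′⊆P (x t) (inWide⇒P′ (x-inWide t))

    below-x : ∀ {S t} z → Wide S → S z ≡ true → chain z ≡ suc t → z ≼ x t ≡ true
    below-x {t = t} z S-wide Sz chain-z =
      proj₂ (proj₂ (greatest-candidate t)) z (candidate-intro (inWide z S-wide Sz) chain-z)

    x-incomparable : ∀ t t′ → t ≢ t′ → x t ≼ x t′ ≡ false
    x-incomparable t t′ t≢t′ with x-inWide t′
    ... | S , S-wide , S∋xt′ with antichain-meets-chains partition (proj₁ S-wide) (proj₂ S-wide) t
    ...   | y , Sy , chain-y = ≢true λ xt≼xt′ →
      ≡true⇒≢false (≼-trans (below-x y S-wide Sy chain-y) xt≼xt′)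
                   (proj₂ (proj₁ S-wide) y (x t′) Sy S∋xt′ y≢xt′)
      where
      y≢xt′ : y ≢ x t′
      y≢xt′ y≡xt′ = t≢t′ (suc-injective (trans (sym chain-y) (trans (cong chain y≡xt′) (x-chain t′))))

    x-antichain : Antichain P k
    x-antichain = record { element = x ; element∈P = x∈P ; incomparable = x-incomparable }

    decomposition-adding-a : (∀ t → x t ≼ a ≡ false) → Decomposition P
    decomposition-adding-a none-below = record
      { width = suc k ; chains = suc k ; chains≤width = ≤-refl
      ; antichain = record { element = element ; element∈P = element∈P ; incomparable = incomparable }
      ; partition = extend partition singleton }
      where
      element : Fin (suc k) → Fin n
      element zero    = a
      element (suc t) = x t
      element∈P : ∀ i → P (element i) ≡ true
      element∈P zero    = proj₁ a-max
      element∈P (suc t) = x∈P t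
      incomparable : ∀ i j → i ≢ j → element i ≼ element j ≡ false
      incomparable zero    zero     i≢j = ⊥-elim (i≢j refl)
      incomparable zero    (suc t)  _   = ≢true λ a≼xt →
        ≡true⇒≢false (proj₂ a-max (x t) (x∈P t) a≼xt) (none-below t)
      incomparable (suc t) zero     _   = none-below t
      incomparable (suc t) (suc t′) i≢j = x-incomparable t t′ (λ e → i≢j (cong suc e))
      singleton : IsChain (_== a)
      singleton y z y≡a z≡a =
        inj₁ (subst₂ (λ u v → u ≼ v ≡ true) (sym (==-true y≡a)) (sym (==-true z≡a)) (≼-refl a))

    module _ (t₀ : Fin k) (xt₀≼a : x t₀ ≼ a ≡ true) where

      K : Fin n → Bool
      K z = (z == a) ∨ (P′ z ∧ ((chain z == suc t₀) ∧ (z ≼ x t₀)))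

      K-intro : ∀ z → P′ z ≡ true → chain z ≡ suc t₀ → z ≼ x t₀ ≡ true → K z ≡ true
      K-intro z P′z chain-z z≼xt₀ = ∨-introʳ (z == a)
        (∧-intro P′z (∧-intro (trans (cong (_== suc t₀) chain-z) (==-refl (suc t₀))) z≼xt₀))

      K-elim : ∀ z → K z ≡ true → z ≡ a ⊎ (P′ z ≡ true × chain z ≡ suc t₀ × z ≼ x t₀ ≡ true)
      K-elim z Kz with ∨-elim (z == a) Kz
      ... | inj₁ z≡a = inj₁ (==-true z≡a)
      ... | inj₂ e   = inj₂ (∧-conicalˡ _ _ e , ==-true (∧-conicalˡ _ _ rest) , ∧-conicalʳ _ _ rest)
        where
        rest : (chain z == suc t₀) ∧ (z ≼ x t₀) ≡ true
        rest = ∧-conicalʳ (P′ z) _ e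

      K-chain : IsChain K
      K-chain y z Ky Kz = comparable (K-elim y Ky) (K-elim z Kz)
        where
        comparable : y ≡ a ⊎ (P′ y ≡ true × chain y ≡ suc t₀ × y ≼ x t₀ ≡ true) →
                     z ≡ a ⊎ (P′ z ≡ true × chain z ≡ suc t₀ × z ≼ x t₀ ≡ true) → Comparable y z
        comparable (inj₁ refl) (inj₁ refl) = inj₁ (≼-refl a)
        comparable (inj₁ refl) (inj₂ (_ , _ , z≼xt₀)) = inj₂ (≼-trans z≼xt₀ xt₀≼a)
        comparable (inj₂ (_ , _ , y≼xt₀)) (inj₁ refl) = inj₁ (≼-trans y≼xt₀ xt₀≼a)
        comparable (inj₂ (P′y , chain-y , _)) (inj₂ (P′z , chain-z , _)) =
          chain-comparable y z P′y P′z (trans chain-y (sym chain-z))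

      P∖K⊆P′ : (P ∖ K) ⊆ P′
      P∖K⊆P′ z e =
        ∖-intro P (_== a) (∧-conicalˡ _ _ e) (Bool.∨-conicalˡ (z == a) _ (not-true (∧-conicalʳ (P z) _ e)))

      open Decomposition (recurse (P ∖ K) P∖K⊆P′) using () renaming
        (width to s″; chains to w″; antichain to A″; partition to C″; chains≤width to w″≤s″)

      -- A wide antichain of P ∖ K would meet the chain t₀ below x t₀, i.e. inside K.
      narrow : s″ < k
      narrow = ≰⇒> k≰s″
        where
        anti″ : IsAntichain P′ (image A″)
        anti″ = IsAntichain-mono P∖K⊆P′ (image-antichain A″)
        k≰s″ : ¬ k ≤ s″
        k≰s″ k≤s″ = ≡true⇒≢false Ky (not-true (∧-conicalʳ (P y) (not (K y)) y∈P∖K))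
          where
          wide : Wide (image A″)
          wide = anti″ , ≤-trans k≤s″ (width≤image A″)
          meet : ∃ λ y → image A″ y ≡ true × chain y ≡ suc t₀
          meet = antichain-meets-chains partition anti″ (proj₂ wide) t₀
          y : Fin n
          y = proj₁ meet
          y∈P∖K : (P ∖ K) y ≡ true
          y∈P∖K = proj₁ (image-antichain A″) y (proj₁ (proj₂ meet))
          Ky : K y ≡ true
          Ky = K-intro y (P∖K⊆P′ y y∈P∖K) (proj₂ (proj₂ meet))
                 (below-x y wide (proj₁ (proj₂ meet)) (proj₂ (proj₂ meet)))

      decomposition-splitting-K : Decomposition P
      decomposition-splitting-K = record
        { width = k ; chains = suc w″ ; antichain = x-antichain
        ; partition = extend C″ K-chain ; chains≤width = ≤-trans (s≤s w″≤s″) narrow }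

    decomposition : Decomposition P
    decomposition with any? (λ t → x t ≼ a Bool.≟ true)
    ... | yes (t₀ , xt₀≼a) = decomposition-splitting-K t₀ xt₀≼a
    ... | no none-below    = decomposition-adding-a (λ t → ≢true λ e → none-below (t , e))

  empty-decomposition : ∀ P → (∀ z → P z ≢ true) → Decomposition P
  empty-decomposition P empty = record
    { width = 0 ; chains = 0 ; chains≤width = z≤n
    ; antichain = record { element = λ () ; element∈P = λ () ; incomparable = λ () }
    ; partition = record { chain = λ _ → zero ; chain≢0 = λ z Pz → ⊥-elim (empty z Pz)
                         ; chain-comparable = λ z _ Pz → ⊥-elim (empty z Pz) } }

  decompose : ∀ f (P : Fin n → Bool) → count P ≤ f → Decomposition P
  decompose f P P≤f with any? (λ z → P z Bool.≟ true)
  ... | no empty = empty-decomposition P (λ z Pz → empty (z , Pz))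
  decompose zero P P≤0 | yes (z , Pz) with () ← subst (_≤ 0) (count-─ P z Pz) P≤0
  decompose (suc f) P P≤f | yes (z , Pz) with maximal P z Pz
  ... | a , a-max = GalvinStep.decomposition a-max λ Q Q⊆P′ →
    decompose f Q (≤-trans (count-mono Q⊆P′) (≤-pred (subst (_≤ suc f) (count-─ P a (proj₁ a-max)) P≤f)))

  dilworth : ∀ P → Decomposition P
  dilworth P = decompose (count P) P ≤-refl

-- Complements, induced 2K2s and co-chordal graphs

cycAdj? : ∀ {k} (i j : Fin k) → Dec (CycAdj i j)
cycAdj? {k} i j =
  (suc (toℕ i) ℕ.≟ toℕ j) ⊎-dec (suc (toℕ j) ℕ.≟ toℕ i)
  ⊎-dec ((toℕ i ℕ.≟ 0) ×-dec (suc (toℕ j) ℕ.≟ k))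
  ⊎-dec ((toℕ j ℕ.≟ 0) ×-dec (suc (toℕ i) ℕ.≟ k))

two-valued : ∀ {a b c : Bool} → a ≢ b → b ≢ c → a ≡ c
two-valued a≢b b≢c = trans (¬-not a≢b) (sym (¬-not (λ c≡b → b≢c (sym c≡b))))

module _ {n} (H : Graph n) where

  complement-edge : ∀ {i j} → adj H i j ≡ false → i ≢ j → Edge (complement H) i j
  complement-edge {i} {j} i≁j i≢j = ∧-intro (cong not i≁j) (cong not (dec-false (i ≟ j) i≢j))

  complement-edge⇒nonadjacent : ∀ {i j} → Edge (complement H) i j → adj H i j ≡ false
  complement-edge⇒nonadjacent e = not-true (∧-conicalˡ _ _ e)

  edge⇒distinct : ∀ {i j} → Edge H i j → i ≢ j
  edge⇒distinct {i} i∼j refl = ≡true⇒≢false i∼j (irrefl H i)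

  record Induced2K2 (p r q s : Fin n) : Set where
    field
      p∼r : Edge H p r
      q∼s : Edge H q s
      p≁q : adj H p q ≡ false
      p≁s : adj H p s ≡ false
      r≁q : adj H r q ≡ false
      r≁s : adj H r s ≡ false

  complement-sym : ∀ {i j} → Edge (complement H) i j → Edge (complement H) j i
  complement-sym {i} {j} e = trans (adj-sym (complement H) j i) e

  complement-irrefl : ∀ {i} → ¬ Edge (complement H) i i
  complement-irrefl {i} e = ≡true⇒≢false e (irrefl (complement H) i)

  induced2K2⇒complement-C4 : ∀ {p r q s} → Induced2K2 p r q s → InducedCycle (complement H) 4
  induced2K2⇒complement-C4 {p} {r} {q} {s} K =
    record { f = f ; injective = injective ; edges = edges ; nonedges = nonedges }
    where
    open Induced2K2 K
    f : Fin 4 → Fin n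
    f 0F = p
    f 1F = q
    f 2F = r
    f 3F = s
    p≢q : p ≢ q
    p≢q refl = ≡true⇒≢false q∼s p≁s
    q≢r : q ≢ r
    q≢r refl = ≡true⇒≢false p∼r p≁q
    r≢s : r ≢ s
    r≢s refl = ≡true⇒≢false p∼r p≁s
    s≢p : s ≢ p
    s≢p refl = ≡true⇒≢false q∼s (trans (adj-sym H q s) p≁q)
    pq : Edge (complement H) p q
    pq = complement-edge p≁q p≢q
    qr : Edge (complement H) q r
    qr = complement-edge (trans (adj-sym H q r) r≁q) q≢r
    rs : Edge (complement H) r s
    rs = complement-edge r≁s r≢s
    sp : Edge (complement H) s p
    sp = complement-edge (trans (adj-sym H s p) p≁s) s≢p
    injective : ∀ i j → f i ≡ f j → i ≡ j
    injective 0F 0F _ = refl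
    injective 1F 1F _ = refl
    injective 2F 2F _ = refl
    injective 3F 3F _ = refl
    injective 0F 1F e = ⊥-elim (p≢q e)
    injective 0F 2F e = ⊥-elim (edge⇒distinct p∼r e)
    injective 0F 3F e = ⊥-elim (s≢p (sym e))
    injective 1F 0F e = ⊥-elim (p≢q (sym e))
    injective 1F 2F e = ⊥-elim (q≢r e)
    injective 1F 3F e = ⊥-elim (edge⇒distinct q∼s e)
    injective 2F 0F e = ⊥-elim (edge⇒distinct p∼r (sym e))
    injective 2F 1F e = ⊥-elim (q≢r (sym e))
    injective 2F 3F e = ⊥-elim (r≢s e)
    injective 3F 0F e = ⊥-elim (s≢p e)
    injective 3F 1F e = ⊥-elim (edge⇒distinct q∼s (sym e))
    injective 3F 2F e = ⊥-elim (r≢s (sym e))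
    edges : ∀ i j → CycAdj i j → Edge (complement H) (f i) (f j)
    edges 0F 1F _ = pq
    edges 1F 2F _ = qr
    edges 2F 3F _ = rs
    edges 3F 0F _ = sp
    edges 1F 0F _ = complement-sym pq
    edges 2F 1F _ = complement-sym qr
    edges 3F 2F _ = complement-sym rs
    edges 0F 3F _ = complement-sym sp
    edges 0F 0F a = ⊥-elim (from-no (cycAdj? {4} 0F 0F) a)
    edges 1F 1F a = ⊥-elim (from-no (cycAdj? {4} 1F 1F) a)
    edges 2F 2F a = ⊥-elim (from-no (cycAdj? {4} 2F 2F) a)
    edges 3F 3F a = ⊥-elim (from-no (cycAdj? {4} 3F 3F) a)
    edges 0F 2F a = ⊥-elim (from-no (cycAdj? {4} 0F 2F) a)
    edges 2F 0F a = ⊥-elim (from-no (cycAdj? {4} 2F 0F) a)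
    edges 1F 3F a = ⊥-elim (from-no (cycAdj? {4} 1F 3F) a)
    edges 3F 1F a = ⊥-elim (from-no (cycAdj? {4} 3F 1F) a)
    nonedges : ∀ i j → Edge (complement H) (f i) (f j) → CycAdj i j
    nonedges 0F 0F e = ⊥-elim (complement-irrefl e)
    nonedges 1F 1F e = ⊥-elim (complement-irrefl e)
    nonedges 2F 2F e = ⊥-elim (complement-irrefl e)
    nonedges 3F 3F e = ⊥-elim (complement-irrefl e)
    nonedges 0F 2F e = ⊥-elim (≡true⇒≢false p∼r (complement-edge⇒nonadjacent e))
    nonedges 2F 0F e = ⊥-elim (≡true⇒≢false p∼r (complement-edge⇒nonadjacent (complement-sym e)))
    nonedges 1F 3F e = ⊥-elim (≡true⇒≢false q∼s (complement-edge⇒nonadjacent e))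
    nonedges 3F 1F e = ⊥-elim (≡true⇒≢false q∼s (complement-edge⇒nonadjacent (complement-sym e)))
    nonedges 0F 1F _ = from-yes (cycAdj? {4} 0F 1F)
    nonedges 1F 2F _ = from-yes (cycAdj? {4} 1F 2F)
    nonedges 2F 3F _ = from-yes (cycAdj? {4} 2F 3F)
    nonedges 3F 0F _ = from-yes (cycAdj? {4} 3F 0F)
    nonedges 1F 0F _ = from-yes (cycAdj? {4} 1F 0F)
    nonedges 2F 1F _ = from-yes (cycAdj? {4} 2F 1F)
    nonedges 3F 2F _ = from-yes (cycAdj? {4} 3F 2F)
    nonedges 0F 3F _ = from-yes (cycAdj? {4} 0F 3F)

  cochordal⇒2K2-free : CoChordal H → ∀ {p r q s} → ¬ Induced2K2 p r q s
  cochordal⇒2K2-free cochordal K with () ← cochordal 4 (s≤s (s≤s (s≤s z≤n))) (induced2K2⇒complement-C4 K)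

  module _ {k} (C : InducedCycle (complement H) k) where
    open InducedCycle C

    nonconsecutive⇒adjacent : ∀ i j → ¬ CycAdj i j → i ≢ j → Edge H (f i) (f j)
    nonconsecutive⇒adjacent i j ¬adj i≢j with adj H (f i) (f j) in e
    ... | true  = refl
    ... | false = ⊥-elim (¬adj (nonedges i j (complement-edge e (λ fi≡fj → i≢j (injective i j fi≡fj)))))

    consecutive⇒nonadjacent : ∀ i j → CycAdj i j → adj H (f i) (f j) ≡ false
    consecutive⇒nonadjacent i j a = complement-edge⇒nonadjacent (edges i j a)

  complement-C4⇒induced2K2 : (C : InducedCycle (complement H) 4) → let open InducedCycle C in
    Induced2K2 (f 0F) (f 2F) (f 1F) (f 3F)
  complement-C4⇒induced2K2 C = record
    { p∼r = nonconsecutive⇒adjacent C 0F 2F (from-no (cycAdj? {4} 0F 2F)) (λ ())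
    ; q∼s = nonconsecutive⇒adjacent C 1F 3F (from-no (cycAdj? {4} 1F 3F)) (λ ())
    ; p≁q = consecutive⇒nonadjacent C 0F 1F (from-yes (cycAdj? {4} 0F 1F))
    ; p≁s = consecutive⇒nonadjacent C 0F 3F (from-yes (cycAdj? {4} 0F 3F))
    ; r≁q = consecutive⇒nonadjacent C 2F 1F (from-yes (cycAdj? {4} 2F 1F))
    ; r≁s = consecutive⇒nonadjacent C 2F 3F (from-yes (cycAdj? {4} 2F 3F)) }

  module _ (c : Fin n → Bool) (bipartite : ∀ i j → Edge H i j → c i ≢ c j) where

    -- Each colour class is a clique of the complement, so the five diagonals of a
    -- long induced cycle form an odd cycle of colour changes.
    complement-no-long-cycle : ∀ m → ¬ InducedCycle (complement H) (5 + m)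
    complement-no-long-cycle m C =
      apart 3F 0F (from-no (cycAdj? {5 + m} 3F 0F)) (λ ()) (sym (trans c₀≡c₄ c₄≡c₃))
      where
      open InducedCycle C
      apart : ∀ i j → ¬ CycAdj i j → i ≢ j → c (f i) ≢ c (f j)
      apart i j ¬adj i≢j = bipartite _ _ (nonconsecutive⇒adjacent C i j ¬adj i≢j)
      c₀≡c₄ : c (f 0F) ≡ c (f 4F)
      c₀≡c₄ = two-valued (apart 0F 2F (from-no (cycAdj? {5 + m} 0F 2F)) (λ ()))
                               (apart 2F 4F (from-no (cycAdj? {5 + m} 2F 4F)) (λ ()))
      c₄≡c₃ : c (f 4F) ≡ c (f 3F)
      c₄≡c₃ = two-valued (apart 4F 1F (from-no (cycAdj? {5 + m} 4F 1F)) (λ ()))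
                               (apart 1F 3F (from-no (cycAdj? {5 + m} 1F 3F)) (λ ()))

    bipartite-2K2-free⇒cochordal : (∀ {p r q s} → ¬ Induced2K2 p r q s) → CoChordal H
    bipartite-2K2-free⇒cochordal _ 3 _ _ = refl
    bipartite-2K2-free⇒cochordal 2K2-free 4 _ C = ⊥-elim (2K2-free (complement-C4⇒induced2K2 C))
    bipartite-2K2-free⇒cochordal _ (suc (suc (suc (suc (suc m))))) _ C = ⊥-elim (complement-no-long-cycle m C)
    bipartite-2K2-free⇒cochordal _ 1 (s≤s ()) _
    bipartite-2K2-free⇒cochordal _ 2 (s≤s (s≤s ())) _

module _ {n} {H : Graph n} where

  Induced2K2-swapˡ : ∀ {p r q s} → Induced2K2 H p r q s → Induced2K2 H r p q s
  Induced2K2-swapˡ K = record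
    { p∼r = trans (adj-sym H _ _) p∼r ; q∼s = q∼s
    ; p≁q = r≁q ; p≁s = r≁s ; r≁q = p≁q ; r≁s = p≁s }
    where open Induced2K2 K

  Induced2K2-swapʳ : ∀ {p r q s} → Induced2K2 H p r q s → Induced2K2 H p r s q
  Induced2K2-swapʳ K = record
    { p∼r = p∼r ; q∼s = trans (adj-sym H _ _) q∼s
    ; p≁q = p≁s ; p≁s = p≁q ; r≁q = r≁s ; r≁s = r≁q }
    where open Induced2K2 K

-- Induced matchings against co-chordal covers

module _ {n} {G : Graph n} where

  subgraph-nonadjacent : ∀ H → Subgraph H G → ∀ {i j} → adj G i j ≡ false → adj H i j ≡ false
  subgraph-nonadjacent H H⊆G {i} {j} i≁j = ≢true λ i∼j → ≡true⇒≢false (H⊆G i j i∼j) i≁j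

  induced-matching-2K2 : ∀ {m} (M : InducedMatching G m) H → Subgraph H G → ∀ {a b} → a ≢ b →
    let open InducedMatching M in
    Edge H (u a) (v a) → Edge H (u b) (v b) → Induced2K2 H (u a) (v a) (u b) (v b)
  induced-matching-2K2 M H H⊆G a≢b ea eb with InducedMatching.induced M _ _ a≢b
  ... | ua≁ub , ua≁vb , va≁ub , va≁vb = record
    { p∼r = ea ; q∼s = eb
    ; p≁q = subgraph-nonadjacent H H⊆G ua≁ub ; p≁s = subgraph-nonadjacent H H⊆G ua≁vb
    ; r≁q = subgraph-nonadjacent H H⊆G va≁ub ; r≁s = subgraph-nonadjacent H H⊆G va≁vb }

  -- Distinct matching edges lie in distinct parts, since a co-chordal graph has no induced 2K2.
  induced-matching≤cover : ∀ {m} → InducedMatching G m → (C : CoChordalCover G) →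
    m ≤ length (CoChordalCover.parts C)
  induced-matching≤cover {m} M C = injective⇒≤ part-injective
    where
    open CoChordalCover C
    open InducedMatching M
    covering : ∀ a → Any (λ H → Edge H (u a) (v a)) parts
    covering a = covers (u a) (v a) (isEdge a)
    part : Fin m → Fin (length parts)
    part a = index (covering a)
    part-injective : ∀ {a b} → part a ≡ part b → a ≡ b
    part-injective {a} {b} same with a ≟ b
    ... | yes a≡b = a≡b
    ... | no a≢b = ⊥-elim (cochordal⇒2K2-free H (proj₁ (lookupAny cochordal (covering a)))
                     (induced-matching-2K2 M H (proj₁ (lookupAny subgraphs (covering a))) a≢b
                       (Any.lookup-index (covering a)) b-in-H))
      where
      H = List.lookup parts (part a)
      b-in-H : Edge H (u b) (v b)
      b-in-H = subst (λ i → Edge (List.lookup parts i) (u b) (v b)) (sym same) (Any.lookup-index (covering b))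

module _ {n} (G : Graph n) where

  IndependentSet : (Fin n → Bool) → Set
  IndependentSet S = ∀ i j → S i ≡ true → S j ≡ true → adj G i j ≡ false

  Dominated : (Fin n → Bool) → Fin n → Set
  Dominated S v = S v ≡ true ⊎ ∃ λ u → S u ≡ true × Edge G v u

  independent-dominating⇒maximal : ∀ {S} → IndependentSet S → (∀ v → Dominated S v) →
    MaximalIndependent G (tabulate S)
  independent-dominating⇒maximal {S} S-ind S-dom = independent , maximal
    where
    member : ∀ {i} → i ∈ₛ tabulate S → S i ≡ true
    member {i} i∈S = trans (sym (lookup∘tabulate S i)) ([]=⇒lookup i∈S)
    member⁻ : ∀ {i} → S i ≡ true → i ∈ₛ tabulate S
    member⁻ {i} Si = lookup⇒[]= i (tabulate S) (trans (lookup∘tabulate S i) Si)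
    independent : Independent G (tabulate S)
    independent i j i∈S j∈S = S-ind i j (member i∈S) (member j∈S)
    maximal : ∀ T → Independent G T → tabulate S ⊆ₛ T → T ⊆ₛ tabulate S
    maximal T T-ind S⊆T {v} v∈T with S-dom v
    ... | inj₁ Sv = member⁻ Sv
    ... | inj₂ (u , Su , v∼u) = ⊥-elim (≡true⇒≢false v∼u (T-ind v u v∈T (S⊆T (member⁻ Su))))

  blocked? : (S : Fin n → Bool) (v : Fin n) → Dec (∃ λ u → S u ≡ true × Edge G v u)
  blocked? S v = any? (λ u → (S u Bool.≟ true) ×-dec (adj G v u Bool.≟ true))

  insert-if-free : (Fin n → Bool) → Fin n → (Fin n → Bool)
  insert-if-free S v with blocked? S v
  ... | yes _ = S
  ... | no _  = λ u → S u ∨ (u == v)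

  greedy : (Fin n → Bool) → List (Fin n) → (Fin n → Bool)
  greedy S []       = S
  greedy S (v ∷ vs) = greedy (insert-if-free S v) vs

  insert-if-free-⊇ : ∀ S v → S ⊆ insert-if-free S v
  insert-if-free-⊇ S v u Su with blocked? S v
  ... | yes _ = Su
  ... | no _  = ∨-introˡ _ Su

  greedy-⊇ : ∀ S vs → S ⊆ greedy S vs
  greedy-⊇ S []       u Su = Su
  greedy-⊇ S (v ∷ vs) u Su = greedy-⊇ (insert-if-free S v) vs u (insert-if-free-⊇ S v u Su)

  insert-if-free-independent : ∀ S v → IndependentSet S → IndependentSet (insert-if-free S v)
  insert-if-free-independent S v S-ind with blocked? S v
  ... | yes _ = S-ind
  ... | no unblocked = λ i j ei ej →
    cases i j (map₂ ==-true (∨-elim (S i) ei)) (map₂ ==-true (∨-elim (S j) ej))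
    where
    free : ∀ u → S u ≡ true → adj G v u ≡ false
    free u Su = ≢true λ v∼u → unblocked (u , Su , v∼u)
    cases : ∀ i j → S i ≡ true ⊎ i ≡ v → S j ≡ true ⊎ j ≡ v → adj G i j ≡ false
    cases i j (inj₁ Si)   (inj₁ Sj)   = S-ind i j Si Sj
    cases i j (inj₁ Si)   (inj₂ refl) = trans (adj-sym G i j) (free i Si)
    cases i j (inj₂ refl) (inj₁ Sj)   = free j Sj
    cases i j (inj₂ refl) (inj₂ refl) = irrefl G i

  insert-if-free-dominates : ∀ S v → Dominated (insert-if-free S v) v
  insert-if-free-dominates S v with blocked? S v
  ... | yes (u , Su , v∼u) = inj₂ (u , Su , v∼u)
  ... | no _               = inj₁ (∨-introʳ (S v) (==-refl v))

  dominated-mono : ∀ {S T v} → S ⊆ T → Dominated S v → Dominated T v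
  dominated-mono S⊆T (inj₁ Sv)            = inj₁ (S⊆T _ Sv)
  dominated-mono S⊆T (inj₂ (u , Su , v∼u)) = inj₂ (u , S⊆T u Su , v∼u)

  greedy-independent : ∀ S vs → IndependentSet S → IndependentSet (greedy S vs)
  greedy-independent S []       S-ind = S-ind
  greedy-independent S (v ∷ vs) S-ind =
    greedy-independent (insert-if-free S v) vs (insert-if-free-independent S v S-ind)

  greedy-dominates : ∀ S {vs v} → v ∈ vs → Dominated (greedy S vs) v
  greedy-dominates S {v ∷ vs} (here refl) =
    dominated-mono (greedy-⊇ (insert-if-free S v) vs) (insert-if-free-dominates S v)
  greedy-dominates S {w ∷ vs} (there v∈vs) = greedy-dominates (insert-if-free S w) v∈vs

  pair : Fin n → Fin n → Fin n → Bool
  pair p q y = (y == p) ∨ (y == q)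

  pair-independent : ∀ {p q} → adj G p q ≡ false → IndependentSet (pair p q)
  pair-independent {p} {q} p≁q i j ei ej =
    cases (map ==-true ==-true (∨-elim (i == p) ei)) (map ==-true ==-true (∨-elim (j == p) ej))
    where
    cases : i ≡ p ⊎ i ≡ q → j ≡ p ⊎ j ≡ q → adj G i j ≡ false
    cases (inj₁ refl) (inj₁ refl) = irrefl G i
    cases (inj₁ refl) (inj₂ refl) = p≁q
    cases (inj₂ refl) (inj₁ refl) = trans (adj-sym G i j) p≁q
    cases (inj₂ refl) (inj₂ refl) = irrefl G i

  record MaximalExtension (S : Fin n → Bool) : Set where
    field
      set         : Fin n → Bool
      ⊇S          : S ⊆ set
      independent : IndependentSet set
      dominating  : ∀ v → Dominated set v

  extend-to-maximal : ∀ {S} → IndependentSet S → MaximalExtension S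
  extend-to-maximal {S} S-ind = record
    { set = greedy S (allFin n) ; ⊇S = greedy-⊇ S (allFin n)
    ; independent = greedy-independent S (allFin n) S-ind
    ; dominating = λ v → greedy-dominates S (∈-allFin v) }

-- Well-covered bipartite graphs

module WellCoveredBipartite {n} (G : Graph n) (well-covered : WellCovered G)
  (c : Fin n → Bool) (bipartite : ∀ i j → Edge G i j → c i ≢ c j) where

  nonIsolated : Fin n → Bool
  nonIsolated x = does (any? λ y → adj G x y Bool.≟ true)

  isolated : Fin n → Bool
  isolated x = not (nonIsolated x)

  edge⇒nonIsolated : ∀ {x y} → Edge G x y → nonIsolated x ≡ true
  edge⇒nonIsolated {x} {y} x∼y = dec-true (any? λ y → adj G x y Bool.≟ true) (y , x∼y)

  isolated-nonadjacent : ∀ {x} y → nonIsolated x ≡ false → adj G x y ≡ false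
  isolated-nonadjacent {x} y isolated =
    ≢true λ x∼y → does-false (any? λ y → adj G x y Bool.≟ true) isolated (y , x∼y)

  same-colour-nonadjacent : ∀ {x y} → c x ≡ c y → adj G x y ≡ false
  same-colour-nonadjacent {x} {y} same = ≢true λ x∼y → bipartite x y x∼y same

  neighbour-colour : ∀ {x y} → Edge G x y → c y ≡ not (c x)
  neighbour-colour {x} {y} x∼y = ¬-not λ cy≡cx → bipartite x y x∼y (sym cy≡cx)

  has-colour : Bool → Fin n → Bool
  has-colour b x = does (c x Bool.≟ b)

  side : Bool → Fin n → Bool
  side b x = has-colour b x ∧ nonIsolated x

  A B : Fin n → Bool
  A = side true
  B = side false

  side⇒colour : ∀ {b x} → side b x ≡ true → c x ≡ b
  side⇒colour {b} {x} e = does-true (c x Bool.≟ b) (∧-conicalˡ _ _ e)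

  side⇒nonIsolated : ∀ {b} → side b ⊆ nonIsolated
  side⇒nonIsolated {b} x = ∧-conicalʳ (has-colour b x) _

  side-intro : ∀ {b x} → c x ≡ b → nonIsolated x ≡ true → side b x ≡ true
  side-intro {b} {x} cx≡b nx = ∧-intro (dec-true (c x Bool.≟ b) cx≡b) nx

  edge-meets-A : ∀ {i j} → Edge G i j → A i ≡ true ⊎ A j ≡ true
  edge-meets-A {i} {j} i∼j = by-colour (c i) refl
    where
    by-colour : ∀ b → c i ≡ b → A i ≡ true ⊎ A j ≡ true
    by-colour true  ci = inj₁ (side-intro ci (edge⇒nonIsolated i∼j))
    by-colour false ci = inj₂ (side-intro (trans (neighbour-colour i∼j) (cong not ci))
                                          (edge⇒nonIsolated (trans (adj-sym G j i) i∼j)))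

  side∪isolated : Bool → Fin n → Bool
  side∪isolated b x = has-colour b x ∨ isolated x

  side∪isolated-independent : ∀ b → IndependentSet G (side∪isolated b)
  side∪isolated-independent b i j ei ej with ∨-elim (has-colour b i) ei | ∨-elim (has-colour b j) ej
  ... | inj₂ i-isolated | _ = isolated-nonadjacent j (not-true i-isolated)
  ... | inj₁ _ | inj₂ j-isolated = trans (adj-sym G i j) (isolated-nonadjacent i (not-true j-isolated))
  ... | inj₁ ci | inj₁ cj =
    same-colour-nonadjacent (trans (does-true (c i Bool.≟ b) ci) (sym (does-true (c j Bool.≟ b) cj)))

  side∪isolated-dominating : ∀ b v → Dominated G (side∪isolated b) v
  side∪isolated-dominating b v with c v Bool.≟ b | nonIsolated v in nv
  ... | yes _ | _ = inj₁ refl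
  ... | no _ | false = inj₁ refl
  ... | no cv≢b | true with does-true (any? λ y → adj G v y Bool.≟ true) nv
  ...   | u , v∼u = inj₂ (u , ∨-introˡ _ (dec-true (c u Bool.≟ b) cu≡b) , v∼u)
    where
    cu≡b : c u ≡ b
    cu≡b = two-valued (λ cu≡cv → bipartite v u v∼u (sym cu≡cv)) cv≢b

  dominating⇒isolated⊆ : ∀ {I} → (∀ v → Dominated G I v) → isolated ⊆ I
  dominating⇒isolated⊆ I-dom v iso with I-dom v
  ... | inj₁ Iv = Iv
  ... | inj₂ (u , _ , v∼u) = ⊥-elim (≡true⇒≢false (edge⇒nonIsolated v∼u) (not-true iso))

  count-maximal : ∀ {I} → (∀ v → Dominated G I v) →
    count I ≡ count (λ x → I x ∧ nonIsolated x) + count isolated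
  count-maximal {I} I-dom =
    trans (count-split I nonIsolated) (cong (count (λ x → I x ∧ nonIsolated x) +_) (count-cong rest))
    where
    rest : ∀ x → I x ∧ isolated x ≡ isolated x
    rest x with nonIsolated x in nx
    ... | true  = Bool.∧-zeroʳ (I x)
    ... | false = trans (Bool.∧-identityʳ (I x)) (dominating⇒isolated⊆ I-dom x (cong not nx))

  side∪isolated∩nonIsolated : ∀ b x → side∪isolated b x ∧ nonIsolated x ≡ side b x
  side∪isolated∩nonIsolated b x with nonIsolated x
  ... | true  = cong (_∧ true) (Bool.∨-identityʳ (has-colour b x))
  ... | false = trans (Bool.∧-zeroʳ (has-colour b x ∨ true)) (sym (Bool.∧-zeroʳ (has-colour b x)))

  count-side∪isolated : ∀ b → count (side∪isolated b) ≡ count (side b) + count isolated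
  count-side∪isolated b = trans (count-maximal (side∪isolated-dominating b))
                                (cong (_+ count isolated) (count-cong (side∪isolated∩nonIsolated b)))

  well-covered-count : ∀ {I J} → IndependentSet G I → (∀ v → Dominated G I v) →
    IndependentSet G J → (∀ v → Dominated G J v) → count I ≡ count J
  well-covered-count {I} {J} I-ind I-dom J-ind J-dom = begin
    count I               ≡⟨ sym (∣tabulate∣≡count I) ⟩
    ∣ tabulate I ∣        ≡⟨ well-covered _ _ (independent-dominating⇒maximal G I-ind I-dom)
                                              (independent-dominating⇒maximal G J-ind J-dom) ⟩
    ∣ tabulate J ∣        ≡⟨ ∣tabulate∣≡count J ⟩
    count J               ∎
    where open ≡-Reasoning

  maximal-nonIsolated-count : ∀ {I} → IndependentSet G I → (∀ v → Dominated G I v) →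
    count (λ x → I x ∧ nonIsolated x) ≡ count B
  maximal-nonIsolated-count {I} I-ind I-dom = +-cancelʳ-≡ (count isolated) _ _ (begin
    count (λ x → I x ∧ nonIsolated x) + count isolated ≡⟨ sym (count-maximal I-dom) ⟩
    count I
      ≡⟨ well-covered-count I-ind I-dom (side∪isolated-independent false) (side∪isolated-dominating false) ⟩
    count (side∪isolated false)                        ≡⟨ count-side∪isolated false ⟩
    count B + count isolated                           ∎)
    where open ≡-Reasoning

  independent-nonIsolated≤B : ∀ {S} → IndependentSet G S → count (λ x → S x ∧ nonIsolated x) ≤ count B
  independent-nonIsolated≤B {S} S-ind = begin
    count (λ x → S x ∧ nonIsolated x)
      ≤⟨ count-mono (λ x e → ∧-intro (⊇S x (∧-conicalˡ _ _ e)) (∧-conicalʳ (S x) _ e)) ⟩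
    count (λ x → set x ∧ nonIsolated x)
      ≡⟨ maximal-nonIsolated-count independent dominating ⟩
    count B ∎
    where
    open MaximalExtension (extend-to-maximal G S-ind)
    open ≤-Reasoning

  _⊑_ : Fin n → Fin n → Bool
  x ⊑ y = (x == y) ∨ (c x ∧ (not (c y) ∧ adj G x y))

  ⊑-elim : ∀ {x y} → x ⊑ y ≡ true → x ≡ y ⊎ (c x ≡ true × c y ≡ false × Edge G x y)
  ⊑-elim {x} {y} e with ∨-elim (x == y) e
  ... | inj₁ x≡y = inj₁ (==-true x≡y)
  ... | inj₂ e′  =
    inj₂ (∧-conicalˡ _ _ e′ , not-true (∧-conicalˡ _ _ rest) , ∧-conicalʳ (not (c y)) _ rest)
    where
    rest : not (c y) ∧ adj G x y ≡ true
    rest = ∧-conicalʳ (c x) _ e′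

  ⊑-refl : ∀ x → x ⊑ x ≡ true
  ⊑-refl x = ∨-introˡ _ (==-refl x)

  ⊑-trans : ∀ {x y z} → x ⊑ y ≡ true → y ⊑ z ≡ true → x ⊑ z ≡ true
  ⊑-trans x⊑y y⊑z with ⊑-elim x⊑y | ⊑-elim y⊑z
  ... | inj₁ refl | _ = y⊑z
  ... | inj₂ _ | inj₁ refl = x⊑y
  ... | inj₂ (_ , cy≡false , _) | inj₂ (cy≡true , _ , _) = ⊥-elim (≡true⇒≢false cy≡true cy≡false)

  ⊑-false : ∀ {x y} → x ≢ y → ¬ (c x ≡ true × c y ≡ false × Edge G x y) → x ⊑ y ≡ false
  ⊑-false x≢y ¬strict = ≢true λ e → [ x≢y , ¬strict ]′ (⊑-elim e)

  edge⇒⊑ : ∀ {x y} → Edge G x y → x ⊑ y ≡ true ⊎ y ⊑ x ≡ true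
  edge⇒⊑ {x} {y} x∼y with c x in cx | neighbour-colour x∼y
  ... | true  | cy = inj₁ (∨-introʳ (x == y) (∧-intro (cong not cy) x∼y))
  ... | false | cy = inj₂ (∨-introʳ (y == x) (∧-intro cy (trans (adj-sym G y x) x∼y)))

  open Dilworth _⊑_ ⊑-refl ⊑-trans

  antichain⇒independent : ∀ {S} → IsAntichain nonIsolated S → IndependentSet G S
  antichain⇒independent (_ , anti) i j Si Sj with i ≟ j
  ... | yes refl = irrefl G i
  ... | no i≢j   = ≢true λ i∼j → [ (λ i⊑j → ≡true⇒≢false i⊑j (anti i j Si Sj i≢j))
                                 , (λ j⊑i → ≡true⇒≢false j⊑i (anti j i Sj Si (λ e → i≢j (sym e)))) ]′
                                 (edge⇒⊑ i∼j)

  independent⇒antichain : ∀ {S} → S ⊆ nonIsolated → IndependentSet G S → IsAntichain nonIsolated S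
  independent⇒antichain S⊆ S-ind = S⊆ , λ x y Sx Sy x≢y →
    ⊑-false x≢y λ (_ , _ , x∼y) → ≡true⇒≢false x∼y (S-ind x y Sx Sy)

  side-antichain : ∀ b → IsAntichain nonIsolated (side b)
  side-antichain b = side⇒nonIsolated , λ x y Sx Sy x≢y →
    ⊑-false x≢y λ (cx , cy , _) →
      ≡true⇒≢false cx (trans (side⇒colour Sx) (trans (sym (side⇒colour Sy)) cy))

  open Decomposition (dilworth nonIsolated)
  open ChainPartition partition

  width≤B : width ≤ count B
  width≤B = begin
    width
      ≤⟨ width≤image antichain ⟩
    count (image antichain)
      ≤⟨ count-mono (λ x e → ∧-intro e (proj₁ anti x e)) ⟩
    count (λ x → image antichain x ∧ nonIsolated x)
      ≤⟨ independent-nonIsolated≤B (antichain⇒independent anti) ⟩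
    count B ∎
    where
    open ≤-Reasoning
    anti = image-antichain antichain

  chains≤B : chains ≤ count B
  chains≤B = ≤-trans chains≤width width≤B

  B-meets-chains : ∀ t → ∃ λ y → B y ≡ true × chain y ≡ suc t
  B-meets-chains = antichain-meets-chains partition (side-antichain false) chains≤B

  -- mate x is the B-vertex on the chain of x; for x outside A it is the junk value x.
  mate : Fin n → Fin n
  mate x with chain x
  ... | zero  = x
  ... | suc t = proj₁ (B-meets-chains t)

  mate-spec : ∀ {x} → A x ≡ true → B (mate x) ≡ true × chain (mate x) ≡ chain x
  mate-spec {x} Ax with chain x | chain≢0 x (side⇒nonIsolated x Ax)
  ... | zero  | ≢0 = ⊥-elim (≢0 refl)
  ... | suc t | _  = proj₂ (B-meets-chains t)

  mate∈B : ∀ {x} → A x ≡ true → B (mate x) ≡ true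
  mate∈B Ax = proj₁ (mate-spec Ax)

  comparable-across : ∀ {x y} → c x ≡ true → c y ≡ false → Comparable x y → Edge G x y
  comparable-across cx cy (inj₁ x⊑y) with ⊑-elim x⊑y
  ... | inj₁ refl          = ⊥-elim (≡true⇒≢false cx cy)
  ... | inj₂ (_ , _ , x∼y) = x∼y
  comparable-across cx cy (inj₂ y⊑x) with ⊑-elim y⊑x
  ... | inj₁ refl          = ⊥-elim (≡true⇒≢false cx cy)
  ... | inj₂ (cy′ , _ , _) = ⊥-elim (≡true⇒≢false cy′ cy)

  mate-adjacent : ∀ {x} → A x ≡ true → Edge G x (mate x)
  mate-adjacent {x} Ax = comparable-across (side⇒colour Ax) (side⇒colour (mate∈B Ax))
    (chain-comparable x (mate x) (side⇒nonIsolated x Ax) (side⇒nonIsolated _ (mate∈B Ax))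
                      (sym (proj₂ (mate-spec Ax))))

  same-chain : ∀ {x u} → A x ≡ true → nonIsolated u ≡ true → chain u ≡ chain x → u ≡ x ⊎ u ≡ mate x
  same-chain {x} {u} Ax nu same with c u in cu
  ... | true  = inj₁ (chain-injective partition (side-antichain true) u x (side-intro cu nu) Ax same)
  ... | false = inj₂ (chain-injective partition (side-antichain false) u (mate x) (side-intro cu nu) (mate∈B Ax)
                        (trans same (sym (proj₂ (mate-spec Ax)))))

  -- If x′ ∼ z failed, a maximal independent set through x′ and z would have its
  -- count B non-isolated vertices on distinct chains other than the chain {x, mate x}.
  mate-neighbourhood : ∀ {x x′ z} → A x ≡ true → Edge G (mate x) x′ → Edge G x z → Edge G x′ z
  mate-neighbourhood {x} {x′} {z} Ax m∼x′ x∼z with adj G x′ z in x′≁z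
  ... | true  = refl
  ... | false = ⊥-elim (<-irrefl refl (begin-strict
    count B                    ≡⟨ sym (maximal-nonIsolated-count independent dominating) ⟩
    count I                    ≤⟨ injective⇒count≤ {q = positive ─ chain x} chain maps (chain-injective partition I-antichain) ⟩
    count (positive ─ chain x) <⟨ ≤-reflexive (sym (count-─ positive (chain x) x-on-chain)) ⟩
    count (positive {chains})  ≡⟨ count-positive chains ⟩
    chains                     ≤⟨ chains≤B ⟩
    count B                    ∎))
    where
    open ≤-Reasoning
    open MaximalExtension (extend-to-maximal G (pair-independent G x′≁z))
    I : Fin n → Bool
    I y = set y ∧ nonIsolated y
    I-antichain : IsAntichain nonIsolated I
    I-antichain = independent⇒antichain (λ y e → ∧-conicalʳ (set y) _ e)
                    (λ i j ei ej → independent i j (∧-conicalˡ _ _ ei) (∧-conicalˡ _ _ ej))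
    x′∈set : set x′ ≡ true
    x′∈set = ⊇S x′ (∨-introˡ _ (==-refl x′))
    z∈set : set z ≡ true
    z∈set = ⊇S z (∨-introʳ (z == x′) (==-refl z))
    off-chain : ∀ y → I y ≡ true → chain y ≢ chain x
    off-chain y Iy same with same-chain Ax (∧-conicalʳ (set y) _ Iy) same
    ... | inj₁ refl = ≡true⇒≢false x∼z (independent y z (∧-conicalˡ _ _ Iy) z∈set)
    ... | inj₂ refl = ≡true⇒≢false m∼x′ (independent y x′ (∧-conicalˡ _ _ Iy) x′∈set)
    x-on-chain : positive (chain x) ≡ true
    x-on-chain = chain-positive partition (side-antichain true) x Ax
    maps : MapsTo I (positive ─ chain x) chain
    maps y Iy = ─-intro positive (chain-positive partition I-antichain y Iy) (off-chain y Iy)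

-- Star graphs of nested neighbourhoods

module _ {n} (G : Graph n) (C : Fin n → Bool) where

  star : Graph n
  star = record
    { adj     = λ i j → adj G i j ∧ (C i ∨ C j)
    ; adj-sym = λ i j → cong₂ _∧_ (adj-sym G i j) (∨-comm (C i) (C j))
    ; irrefl  = λ i → cong (_∧ (C i ∨ C i)) (irrefl G i) }

  star-subgraph : Subgraph star G
  star-subgraph i j = ∧-conicalˡ _ _

  star-edgeˡ : ∀ {i j} → Edge G i j → C i ≡ true → Edge star i j
  star-edgeˡ {i} {j} i∼j Ci = ∧-intro i∼j (∨-introˡ (C j) Ci)

  star-edgeʳ : ∀ {i j} → Edge G i j → C j ≡ true → Edge star i j
  star-edgeʳ {i} {j} i∼j Cj = ∧-intro i∼j (∨-introʳ (C i) Cj)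

  Nested : Set
  Nested = ∀ p q → C p ≡ true → C q ≡ true →
    (∀ j → Edge G p j → Edge G q j) ⊎ (∀ j → Edge G q j → Edge G p j)

  star-edge-centre : ∀ {p r} → Edge star p r → C p ≡ true ⊎ C r ≡ true
  star-edge-centre {p} {r} e = ∨-elim (C p) (∧-conicalʳ (adj G p r) _ e)

  -- Nested neighbourhoods join the centre of one edge to the far end of the other.
  star-2K2-centred : Nested → ∀ {p r q s} → Induced2K2 star p r q s → C p ≡ true → C q ≡ true → ⊥
  star-2K2-centred nested {p} {r} {q} {s} K Cp Cq with nested p q Cp Cq
  ... | inj₁ Np⊆Nq = ≡true⇒≢false (star-edgeˡ (Np⊆Nq r (star-subgraph p r p∼r)) Cq)
                       (trans (adj-sym star q r) r≁q)
    where open Induced2K2 K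
  ... | inj₂ Nq⊆Np = ≡true⇒≢false (star-edgeˡ (Nq⊆Np s (star-subgraph q s q∼s)) Cp) p≁s
    where open Induced2K2 K

  star-2K2-free : Nested → ∀ {p r q s} → ¬ Induced2K2 star p r q s
  star-2K2-free nested K with star-edge-centre (Induced2K2.p∼r K) | star-edge-centre (Induced2K2.q∼s K)
  ... | inj₁ Cp | inj₁ Cq = star-2K2-centred nested K Cp Cq
  ... | inj₁ Cp | inj₂ Cs = star-2K2-centred nested (Induced2K2-swapʳ K) Cp Cs
  ... | inj₂ Cr | inj₁ Cq = star-2K2-centred nested (Induced2K2-swapˡ K) Cr Cq
  ... | inj₂ Cr | inj₂ Cs = star-2K2-centred nested (Induced2K2-swapˡ (Induced2K2-swapʳ K)) Cr Cs

  star-cochordal : Nested → (c : Fin n → Bool) → (∀ i j → Edge G i j → c i ≢ c j) → CoChordal star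
  star-cochordal nested c bipartite = bipartite-2K2-free⇒cochordal star c
    (λ i j e → bipartite i j (star-subgraph i j e)) (star-2K2-free nested)

-- The neighbourhood order on A

module NeighbourhoodOrder {n} (G : Graph n) (well-covered : WellCovered G)
  (c : Fin n → Bool) (bipartite : ∀ i j → Edge G i j → c i ≢ c j) where

  open WellCoveredBipartite G well-covered c bipartite

  _≼_ : Fin n → Fin n → Bool
  x ≼ y = does (all? λ j → (adj G x j Bool.≟ true) →-dec (adj G y j Bool.≟ true))

  ≼-intro : ∀ {x y} → (∀ j → Edge G x j → Edge G y j) → x ≼ y ≡ true
  ≼-intro {x} {y} = dec-true (all? λ j → (adj G x j Bool.≟ true) →-dec (adj G y j Bool.≟ true))

  ≼-elim : ∀ {x y} → x ≼ y ≡ true → ∀ j → Edge G x j → Edge G y j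
  ≼-elim {x} {y} = does-true (all? λ j → (adj G x j Bool.≟ true) →-dec (adj G y j Bool.≟ true))

  ≼-refl : ∀ x → x ≼ x ≡ true
  ≼-refl x = ≼-intro λ _ e → e

  ≼-trans : ∀ {x y z} → x ≼ y ≡ true → y ≼ z ≡ true → x ≼ z ≡ true
  ≼-trans x≼y y≼z = ≼-intro λ j e → ≼-elim y≼z j (≼-elim x≼y j e)

  open Dilworth _≼_ ≼-refl ≼-trans
  open Decomposition (dilworth A)
  open ChainPartition partition
  open Antichain antichain

  mate⇒≼ : ∀ {x y} → A x ≡ true → Edge G (mate x) y → x ≼ y ≡ true
  mate⇒≼ Ax m∼y = ≼-intro λ j x∼j → mate-neighbourhood Ax m∼y x∼j

  colour-element : ∀ a → c (element a) ≡ true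
  colour-element a = side⇒colour (element∈P a)

  colour-mate : ∀ a → c (mate (element a)) ≡ false
  colour-mate a = side⇒colour (mate∈B (element∈P a))

  colour-apart : ∀ {x y} → c x ≡ true → c y ≡ false → x ≢ y
  colour-apart cx cy refl = ≡true⇒≢false cx cy

  mate-nonadjacent : ∀ a b → a ≢ b → adj G (mate (element a)) (element b) ≡ false
  mate-nonadjacent a b a≢b = ≢true λ m∼e →
    ≡true⇒≢false (mate⇒≼ (element∈P a) m∼e) (incomparable a b a≢b)

  elements-distinct : ∀ {a b} → a ≢ b → element a ≢ element b
  elements-distinct a≢b e = a≢b (element-injective antichain e)

  mates-distinct : ∀ {a b} → a ≢ b → mate (element a) ≢ mate (element b)
  mates-distinct {a} {b} a≢b e = ≡true⇒≢false
    (subst (λ y → Edge G y (element b)) (sym e) (trans (adj-sym G _ _) (mate-adjacent (element∈P b))))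
    (mate-nonadjacent a b a≢b)

  matching : InducedMatching G width
  matching = record
    { u = element ; v = λ a → mate (element a) ; isEdge = λ a → mate-adjacent (element∈P a)
    ; disjoint = λ a b a≢b →
        elements-distinct a≢b ,
        colour-apart (colour-element a) (colour-mate b) ,
        (λ e → colour-apart (colour-element b) (colour-mate a) (sym e)) ,
        mates-distinct a≢b
    ; induced = λ a b a≢b →
        same-colour-nonadjacent (trans (colour-element a) (sym (colour-element b))) ,
        trans (adj-sym G _ _) (mate-nonadjacent b a (λ e → a≢b (sym e))) ,
        mate-nonadjacent a b a≢b ,
        same-colour-nonadjacent (trans (colour-mate a) (sym (colour-mate b))) }

  on-chain : Fin chains → Fin n → Bool
  on-chain t x = A x ∧ (chain x == suc t)

  on-chain-nested : ∀ t → Nested G (on-chain t)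
  on-chain-nested t p q ep eq
    with chain-comparable p q (∧-conicalˡ _ _ ep) (∧-conicalˡ _ _ eq)
           (trans (==-true (∧-conicalʳ (A p) _ ep)) (sym (==-true (∧-conicalʳ (A q) _ eq))))
  ... | inj₁ p≼q = inj₁ (≼-elim p≼q)
  ... | inj₂ q≼p = inj₂ (≼-elim q≼p)

  A-on-some-chain : ∀ {x} → A x ≡ true → ∃ λ t → on-chain t x ≡ true
  A-on-some-chain {x} Ax with chain x | chain≢0 x Ax
  ... | zero  | ≢0 = ⊥-elim (≢0 refl)
  ... | suc t | _  = t , ∧-intro Ax (==-refl (suc t))

  chain-stars : List (Graph n)
  chain-stars = List.tabulate λ t → star G (on-chain t)

  chain-stars-cover : ∀ i j → Edge G i j → Any (λ H → Edge H i j) chain-stars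
  chain-stars-cover i j i∼j with edge-meets-A i∼j
  ... | inj₁ Ai with A-on-some-chain Ai
  ...   | t , it = Any.tabulate⁺ t (star-edgeˡ G (on-chain t) i∼j it)
  chain-stars-cover i j i∼j | inj₂ Aj with A-on-some-chain Aj
  ...   | t , jt = Any.tabulate⁺ t (star-edgeʳ G (on-chain t) i∼j jt)

  cover : CoChordalCover G
  cover = record
    { parts     = chain-stars
    ; subgraphs = All.tabulate⁺ λ t → star-subgraph G (on-chain t)
    ; cochordal = All.tabulate⁺ λ t → star-cochordal G (on-chain t) (on-chain-nested t) c bipartite
    ; covers    = chain-stars-cover }

  matching-and-cover :
    Σ ℕ λ s → InducedMatching G s × Σ (CoChordalCover G) λ C → length (CoChordalCover.parts C) ≤ s
  matching-and-cover = width , matching , cover , ≤-trans (≤-reflexive (length-tabulate _)) chains≤width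

theorem4p5 : ∀ {n} (G : Graph n) → WellCovered G → Bipartite G →
    Σ ℕ λ k → IsIndmatch G k × IsCochord G k
theorem4p5 G well-covered (c , bipartite)
  with NeighbourhoodOrder.matching-and-cover G well-covered c bipartite
... | s , M , C , C≤s =
  s , (M , λ m M′ → ≤-trans (induced-matching≤cover M′ C) C≤s)
    , (C , ≤-antisym C≤s (induced-matching≤cover M C)) , induced-matching≤cover M
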